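{- $\mathbf{PF}$ is a conservative extension of $\mathbf{GL}$: for every $\mathcal L_{\mathsf p}$-formula $A$, $\mathbf{PF}\vdash A$ iff $\mathbf{GL}\vdash A$.
   Context: $\mathcal L_{\mathsf p}$ is the unimodal propositional language with modal operator $\Box_{\mathsf p}$; $\mathcal L_{\mathsf{pf}}$ adds a second operator $\Box_{\mathsf f}$ ($\Diamond=\neg\Box\neg$). $\mathbf{GL}$ has axioms: propositional tautologies, $\Box_{\mathsf p}(A\to B)\to(\Box_{\mathsf p}A\to\Box_{\mathsf p}B)$, $\Box_{\mathsf p}(\Box_{\mathsf p}A\to A)\to\Box_{\mathsf p}A$; rules modus ponens and $\Box_{\mathsf p}$-necessitation. $\mathbf{PF}$ (in $\mathcal L_{\mathsf{pf}}$) has axioms: propositional tautologies; the $\mathbf{GL}$ axioms; $\Box_{\mathsf f}(A\to B)\to(\Box_{\mathsf f}A\to\Box_{\mathsf f}B)$; $\Box_{\mathsf f}A\to A$; $\Box_{\mathsf f}A\to\Box_{\mathsf f}\Box_{\mathsf f}A$; $\Diamond_{\mathsf f}\Box_{\mathsf f}A\to\Box_{\mathsf f}\Diamond_{\mathsf f}A$; $\Box_{\mathsf p}A\to\Box_{\mathsf f}\Box_{\mathsf p}A$; $\Diamond_{\mathsf p}A\to\Box_{\mathsf f}\Diamond_{\mathsf p}A$; $\Box_{\mathsf p}A\to\Box_{\mathsf p}\Box_{\mathsf f}A$; rules modus ponens and necessitation for $\Box_{\mathsf p}$ and $\Box_{\mathsf f}$. -}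

module Defs where

open import Data.Nat using (ℕ)
open import Data.Bool using (Bool; true; false; not; _∨_)

data FmP : Set where
  var  : ℕ → FmP
  ⊥'   : FmP
  _⇒_  : FmP → FmP → FmP
  □p   : FmP → FmP

infixr 5 _⇒_

data Fm : Set where
  var  : ℕ → Fm
  ⊥'   : Fm
  _⇒_  : Fm → Fm → Fm
  □p   : Fm → Fm
  □f   : Fm → Fm

¬f : Fm → Fm
¬f A = A ⇒ ⊥'

◇p : Fm → Fm
◇p A = ¬f (□p (¬f A))

◇f : Fm → Fm
◇f A = ¬f (□f (¬f A))

-- Propositional tautologies: true under every Boolean valuation,
-- where modalised subformulas (□ A) are treated as propositional atoms.
evalP : (ℕ → Bool) → (FmP → Bool) → FmP → Bool
evalP v b (var n) = v n
evalP v b ⊥' = false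
evalP v b (A ⇒ B) = not (evalP v b A) ∨ evalP v b B
evalP v b (□p A) = b A

TautP : FmP → Set
TautP A = (v : ℕ → Bool) (b : FmP → Bool) → evalP v b A ≡ true
  where open import Relation.Binary.PropositionalEquality using (_≡_)

evalPF : (ℕ → Bool) → (Fm → Bool) → (Fm → Bool) → Fm → Bool
evalPF v bp bf (var n) = v n
evalPF v bp bf ⊥' = false
evalPF v bp bf (A ⇒ B) = not (evalPF v bp bf A) ∨ evalPF v bp bf B
evalPF v bp bf (□p A) = bp A
evalPF v bp bf (□f A) = bf A

Taut : Fm → Set
Taut A = (v : ℕ → Bool) (bp bf : Fm → Bool) → evalPF v bp bf A ≡ true
  where open import Relation.Binary.PropositionalEquality using (_≡_)

data GL⊢_ : FmP → Set where
  taut : ∀ {A} → TautP A → GL⊢ A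
  K    : ∀ A B → GL⊢ (□p (A ⇒ B) ⇒ (□p A ⇒ □p B))
  Löb  : ∀ A → GL⊢ (□p (□p A ⇒ A) ⇒ □p A)
  mp   : ∀ {A B} → GL⊢ (A ⇒ B) → GL⊢ A → GL⊢ B
  nec  : ∀ {A} → GL⊢ A → GL⊢ □p A

data PF⊢_ : Fm → Set where
  taut  : ∀ {A} → Taut A → PF⊢ A
  Kp    : ∀ A B → PF⊢ (□p (A ⇒ B) ⇒ (□p A ⇒ □p B))
  Löb   : ∀ A → PF⊢ (□p (□p A ⇒ A) ⇒ □p A)
  Kf    : ∀ A B → PF⊢ (□f (A ⇒ B) ⇒ (□f A ⇒ □f B))
  Tf    : ∀ A → PF⊢ (□f A ⇒ A)
  4f    : ∀ A → PF⊢ (□f A ⇒ □f (□f A))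
  ax2f   : ∀ A → PF⊢ (◇f (□f A) ⇒ □f (◇f A))
  pf1   : ∀ A → PF⊢ (□p A ⇒ □f (□p A))
  pf2   : ∀ A → PF⊢ (◇p A ⇒ □f (◇p A))
  pf3   : ∀ A → PF⊢ (□p A ⇒ □p (□f A))
  mp    : ∀ {A B} → PF⊢ (A ⇒ B) → PF⊢ A → PF⊢ B
  necp  : ∀ {A} → PF⊢ A → PF⊢ □p A
  necf  : ∀ {A} → PF⊢ A → PF⊢ □f A

emb : FmP → Fm
emb (var n) = var n
emb ⊥' = ⊥'
emb (A ⇒ B) = emb A ⇒ emb B
emb (□p A) = □p (emb A)

-- GL-theorems stay PF-theorems, since every GL axiom and rule is one of PF.
-- Conversely, erasing □f sends each PF axiom to a GL axiom, to a tautology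
-- of the form X → X (all □f axioms and the three mixed axioms), or, for a
-- tautology, to a tautology; □f-necessitation becomes trivial.  Erasure
-- undoes the embedding, so PF ⊢ A yields GL ⊢ A.
module Submission where

open import Defs
open import Data.Bool using (not; _∨_)
open import Data.Bool.Properties using (∨-inverseˡ)
open import Function.Bundles using (_⇔_; mk⇔)
open import Relation.Binary.PropositionalEquality using (_≡_; refl; sym; trans; cong; cong₂; subst)

erase-□f : Fm → FmP
erase-□f (var n) = var n
erase-□f ⊥' = ⊥'
erase-□f (A ⇒ B) = erase-□f A ⇒ erase-□f B
erase-□f (□p A) = □p (erase-□f A)
erase-□f (□f A) = erase-□f A

erase-□f∘emb : ∀ A → erase-□f (emb A) ≡ A
erase-□f∘emb (var n) = refl
erase-□f∘emb ⊥' = refl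
erase-□f∘emb (A ⇒ B) = cong₂ _⇒_ (erase-□f∘emb A) (erase-□f∘emb B)
erase-□f∘emb (□p A) = cong □p (erase-□f∘emb A)

evalPF-erase-□f : ∀ v b A →
  evalPF v (λ C → b (erase-□f C)) (λ C → evalP v b (erase-□f C)) A ≡ evalP v b (erase-□f A)
evalPF-erase-□f v b (var n) = refl
evalPF-erase-□f v b ⊥' = refl
evalPF-erase-□f v b (A ⇒ B) =
  cong₂ (λ x y → not x ∨ y) (evalPF-erase-□f v b A) (evalPF-erase-□f v b B)
evalPF-erase-□f v b (□p A) = refl
evalPF-erase-□f v b (□f A) = refl

Taut⇒TautP-erase-□f : ∀ A → Taut A → TautP (erase-□f A)
Taut⇒TautP-erase-□f A t v b = trans (sym (evalPF-erase-□f v b A)) (t v _ _)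

evalPF-emb : ∀ v bp bf A → evalPF v bp bf (emb A) ≡ evalP v (λ C → bp (emb C)) A
evalPF-emb v bp bf (var n) = refl
evalPF-emb v bp bf ⊥' = refl
evalPF-emb v bp bf (A ⇒ B) =
  cong₂ (λ x y → not x ∨ y) (evalPF-emb v bp bf A) (evalPF-emb v bp bf B)
evalPF-emb v bp bf (□p A) = refl

TautP⇒Taut-emb : ∀ A → TautP A → Taut (emb A)
TautP⇒Taut-emb A t v bp bf = trans (evalPF-emb v bp bf A) (t v _)

GL⊢-⇒-refl : ∀ A → GL⊢ (A ⇒ A)
GL⊢-⇒-refl A = taut (λ v b → ∨-inverseˡ (evalP v b A))

PF⊢⇒GL⊢erase-□f : ∀ {A} → PF⊢ A → GL⊢ erase-□f A
PF⊢⇒GL⊢erase-□f {A} (taut t) = taut (Taut⇒TautP-erase-□f A t)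
PF⊢⇒GL⊢erase-□f (Kp A B) = K (erase-□f A) (erase-□f B)
PF⊢⇒GL⊢erase-□f (Löb A) = Löb (erase-□f A)
PF⊢⇒GL⊢erase-□f (Kf A B) = GL⊢-⇒-refl _
PF⊢⇒GL⊢erase-□f (Tf A) = GL⊢-⇒-refl _
PF⊢⇒GL⊢erase-□f (4f A) = GL⊢-⇒-refl _
PF⊢⇒GL⊢erase-□f (ax2f A) = GL⊢-⇒-refl _
PF⊢⇒GL⊢erase-□f (pf1 A) = GL⊢-⇒-refl _
PF⊢⇒GL⊢erase-□f (pf2 A) = GL⊢-⇒-refl _
PF⊢⇒GL⊢erase-□f (pf3 A) = GL⊢-⇒-refl _
PF⊢⇒GL⊢erase-□f (mp d e) = mp (PF⊢⇒GL⊢erase-□f d) (PF⊢⇒GL⊢erase-□f e)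
PF⊢⇒GL⊢erase-□f (necp d) = nec (PF⊢⇒GL⊢erase-□f d)
PF⊢⇒GL⊢erase-□f (necf d) = PF⊢⇒GL⊢erase-□f d

GL⊢⇒PF⊢emb : ∀ {A} → GL⊢ A → PF⊢ emb A
GL⊢⇒PF⊢emb {A} (taut t) = taut (TautP⇒Taut-emb A t)
GL⊢⇒PF⊢emb (K A B) = Kp (emb A) (emb B)
GL⊢⇒PF⊢emb (Löb A) = Löb (emb A)
GL⊢⇒PF⊢emb (mp d e) = mp (GL⊢⇒PF⊢emb d) (GL⊢⇒PF⊢emb e)
GL⊢⇒PF⊢emb (nec d) = necp (GL⊢⇒PF⊢emb d)

corollaryA3 : (A : FmP) → (PF⊢ emb A) ⇔ (GL⊢ A)
corollaryA3 A = mk⇔ (λ d → subst GL⊢_ (erase-□f∘emb A) (PF⊢⇒GL⊢erase-□f d)) GL⊢⇒PF⊢emb
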